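{- Let $t$ be a positive integer with $t\equiv 31\pmod{56}$. Then $18107_2^{(t)}=18107\cdot(2^{15t}-1)/(2^{15}-1)$ is a Riesel number.
   Context: A Riesel number is an odd positive integer $k$ such that $k\cdot 2^n-1$ is composite for all positive integers $n$. For integers $b\ge2$, $k\ge1$, $t\ge1$, the $b$-repinteger is $k_b^{(t)}=k\,(b^{\ell t}-1)/(b^\ell-1)$ with $\ell=\lfloor\log_b k\rfloor+1$; for $k=18107$, $b=2$ one has $\ell=15$. -}

module Defs where

open import Data.Nat using (ℕ; suc; _+_; _*_; _∸_; _^_; _≤_; _<_)
open import Data.Nat.DivMod using (_/_; _%_)
open import Data.Nat.Logarithm using (⌊log₂_⌋)
open import Data.Nat.Primality using (Composite)
open import Data.Product using (_×_)

RieselNumber : ℕ → Set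
RieselNumber k = (1 ≤ k) × (k % 2 ≡ 1) × ((n : ℕ) → 1 ≤ n → Composite (k * 2 ^ n ∸ 1))
  where open import Relation.Binary.PropositionalEquality using (_≡_)

len₂ : ℕ → ℕ
len₂ k = ⌊log₂ k ⌋ + 1

-- The 2-repinteger k_2^{(t)} = k (2^{ℓ t} − 1) / (2^ℓ − 1).
-- Since ℓ ≥ 1, 2^ℓ − 1 = suc (2^ℓ ∸ 2); written this way so the divisor is visibly nonzero.
repint₂ : ℕ → ℕ → ℕ
repint₂ k t = (k * (2 ^ (len₂ k * t) ∸ 1)) / suc (2 ^ len₂ k ∸ 2)

{-# OPTIONS --safe #-}
-- With R_t = 1 + 2^15 + ... + 2^(15(t-1)) the repinteger is N_t = 18107 R_t.
-- Each prime p in {3, 5, 7, 13, 17, 241} divides both 2^24 - 1 and R_56, so modulo p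
-- N_t depends only on t mod 56 and 2^n only on n mod 24. For t = 31 every residue
-- r mod 24 has such a p dividing N_31 2^r - 1, hence p divides N_t 2^n - 1 for all
-- t ≡ 31 (mod 56) and n ≡ r (mod 24); being smaller than N_t 2^n - 1 it is a proper
-- divisor. N_t is odd since 18107 and R_t are.
module Submission where

open import Defs
open import Data.Nat using (ℕ; _%_; _≤_)
open import Relation.Binary.PropositionalEquality using (_≡_)

open import Data.Nat
  using (zero; suc; _+_; _*_; _∸_; _^_; _<_; _/_; ⌊_/2⌋; _<?_; NonZero; NonTrivial; z≤n; s≤s; z<s; s≤s⁻¹; n>1⇒nonTrivial)
open import Data.Nat.Properties
open import Data.Nat.DivMod using (_divMod_; result; m≡m%n+[m/n]*n; m*n/n≡m; %-remove-+ʳ; m<n⇒m%n≡m)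
open import Data.Nat.Divisibility
open import Data.Nat.Logarithm using (⌊log₂_⌋; ⌊log₂⌋-mono-≤; ⌊log₂[2^n]⌋≡n; ⌊log₂⌊n/2⌋⌋≡⌊log₂n⌋∸1)
open import Data.Nat.Primality using (Composite; composite)
open import Data.Nat.Tactic.RingSolver using (solve-∀)
open import Data.Fin using (Fin; toℕ)
open import Data.Fin.Properties using (all?)
open import Data.Vec using (Vec; []; _∷_; lookup)
open import Data.Product using (_×_; _,_; proj₁; proj₂; ∃-syntax)
open import Relation.Nullary using (Dec)
open import Relation.Nullary.Decidable using (toWitness; map′; _×-dec_)
open import Relation.Binary.PropositionalEquality using (refl; sym; trans; cong; subst; module ≡-Reasoning)

repunit : ℕ → ℕ → ℕ
repunit b zero    = 0
repunit b (suc t) = 1 + b * repunit b t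

repunit>0 : ∀ b {t} → 0 < t → 0 < repunit b t
repunit>0 b {suc t} _ = s≤s z≤n

∣b⇒∣repunit∸1 : ∀ {p b t} → p ∣ b → 0 < t → p ∣ repunit b t ∸ 1
∣b⇒∣repunit∸1 {t = suc t} p∣b _ = ∣m⇒∣m*n (repunit _ t) p∣b

repunit-+ : ∀ b m n → repunit b (m + n) ≡ repunit b m + b ^ m * repunit b n
repunit-+ b zero    n = sym (*-identityˡ (repunit b n))
repunit-+ b (suc m) n = begin
  1 + b * repunit b (m + n)                        ≡⟨ cong (λ x → 1 + b * x) (repunit-+ b m n) ⟩
  1 + b * (repunit b m + b ^ m * repunit b n)      ≡⟨ cong suc (*-distribˡ-+ b _ _) ⟩
  1 + (b * repunit b m + b * (b ^ m * repunit b n)) ≡⟨ cong (λ x → 1 + (b * repunit b m + x)) (sym (*-assoc b (b ^ m) _)) ⟩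
  1 + (b * repunit b m + b * b ^ m * repunit b n)  ∎
  where open ≡-Reasoning

repunit∣repunit[q*n] : ∀ b n q → repunit b n ∣ repunit b (q * n)
repunit∣repunit[q*n] b n zero    = repunit b n ∣0
repunit∣repunit[q*n] b n (suc q) = subst (repunit b n ∣_) (sym (repunit-+ b n (q * n)))
  (∣m∣n⇒∣m+n ∣-refl (∣n⇒∣m*n (b ^ n) (repunit∣repunit[q*n] b n q)))

[1+c]^n≡1+c*repunit : ∀ c n → suc c ^ n ≡ 1 + c * repunit (suc c) n
[1+c]^n≡1+c*repunit c zero    = cong suc (sym (*-zeroʳ c))
[1+c]^n≡1+c*repunit c (suc n) = trans (cong (suc c *_) ([1+c]^n≡1+c*repunit c n)) (expand c (repunit (suc c) n))
  where
  expand : ∀ c x → (1 + c) * (1 + c * x) ≡ 1 + c * (1 + (1 + c) * x)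
  expand = solve-∀

k*[[1+c]^n∸1]/c≡k*repunit : ∀ k c .{{_ : NonZero c}} n → k * (suc c ^ n ∸ 1) / c ≡ k * repunit (suc c) n
k*[[1+c]^n∸1]/c≡k*repunit k c n = begin
  k * (suc c ^ n ∸ 1) / c ≡⟨ cong (λ x → k * (x ∸ 1) / c) ([1+c]^n≡1+c*repunit c n) ⟩
  k * (c * R) / c         ≡⟨ cong (λ x → k * x / c) (*-comm c R) ⟩
  k * (R * c) / c         ≡⟨ cong (_/ c) (sym (*-assoc k R c)) ⟩
  k * R * c / c           ≡⟨ m*n/n≡m (k * R) c ⟩
  k * R                   ∎
  where
  open ≡-Reasoning
  R = repunit (suc c) n

repint₂≡k*repunit : ∀ k t → repint₂ k t ≡ k * repunit (2 ^ len₂ k) t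
repint₂≡k*repunit k t = begin
  k * (2 ^ (ℓ * t) ∸ 1) / c        ≡⟨ cong (λ x → k * (x ∸ 1) / c) (sym (^-*-assoc 2 ℓ t)) ⟩
  k * ((2 ^ ℓ) ^ t ∸ 1) / c        ≡⟨ cong (λ B → k * (B ^ t ∸ 1) / c) 2^ℓ≡1+c ⟩
  k * (suc c ^ t ∸ 1) / c          ≡⟨ k*[[1+c]^n∸1]/c≡k*repunit k c t ⟩
  k * repunit (suc c) t            ≡⟨ cong (λ B → k * repunit B t) (sym 2^ℓ≡1+c) ⟩
  k * repunit (2 ^ ℓ) t            ∎
  where
  open ≡-Reasoning
  ℓ = len₂ k
  c = suc (2 ^ ℓ ∸ 2)
  2^ℓ≡1+c : 2 ^ ℓ ≡ suc c
  2^ℓ≡1+c = sym (m+[n∸m]≡n (^-monoʳ-≤ 2 (m≤n+m 1 ⌊log₂ k ⌋)))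

⌊n/2⌋<m : ∀ n {m} → n < m + m → ⌊ n /2⌋ < m
⌊n/2⌋<m zero          {suc m} _ = z<s
⌊n/2⌋<m (suc zero)    {suc m} _ = z<s
⌊n/2⌋<m (suc (suc n)) {suc m} (s≤s 2+n≤m+1+m) = s≤s (⌊n/2⌋<m n (s≤s⁻¹ (subst (suc (suc n) ≤_) (+-suc m m) 2+n≤m+1+m)))

⌊log₂⌋≤ : ∀ m {n} → n < 2 ^ suc m → ⌊log₂ n ⌋ ≤ m
⌊log₂⌋≤ zero    {zero}        _ = z≤n
⌊log₂⌋≤ zero    {suc zero}    _ = z≤n
⌊log₂⌋≤ zero    {suc (suc n)} (s≤s (s≤s ()))
⌊log₂⌋≤ (suc m) {n} n<2^[2+m] = begin
  ⌊log₂ n ⌋               ≤⟨ m≤n+m∸n ⌊log₂ n ⌋ 1 ⟩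
  1 + (⌊log₂ n ⌋ ∸ 1)     ≡⟨ cong (1 +_) (sym (⌊log₂⌊n/2⌋⌋≡⌊log₂n⌋∸1 n)) ⟩
  1 + ⌊log₂ ⌊ n /2⌋ ⌋     ≤⟨ +-monoʳ-≤ 1 (⌊log₂⌋≤ m (⌊n/2⌋<m n n<2^[1+m]+2^[1+m])) ⟩
  1 + m                   ∎
  where
  open ≤-Reasoning
  n<2^[1+m]+2^[1+m] : n < 2 ^ suc m + 2 ^ suc m
  n<2^[1+m]+2^[1+m] = subst (n <_) (cong (2 ^ suc m +_) (+-identityʳ (2 ^ suc m))) n<2^[2+m]

⌊log₂n⌋≡m : ∀ m {n} → 2 ^ m ≤ n → n < 2 ^ suc m → ⌊log₂ n ⌋ ≡ m
⌊log₂n⌋≡m m 2^m≤n n<2^[1+m] = ≤-antisym (⌊log₂⌋≤ m n<2^[1+m])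
  (subst (_≤ _) (⌊log₂[2^n]⌋≡n m) (⌊log₂⌋-mono-≤ 2^m≤n))

len₂≡1+m : ∀ m {k} → 2 ^ m ≤ k → k < 2 ^ suc m → len₂ k ≡ suc m
len₂≡1+m m 2^m≤k k<2^[1+m] = trans (cong (_+ 1) (⌊log₂n⌋≡m m 2^m≤k k<2^[1+m])) (+-comm m 1)

-- Congruences x ≡ 1 (mod p) are written p ∣ x ∸ 1, which is instance-free and decidable;
-- x = 0 satisfies it vacuously, hence the positivity hypotheses.
∣∸1-+ : ∀ {p x y} → 0 < x → p ∣ x ∸ 1 → p ∣ y → p ∣ x + y ∸ 1
∣∸1-+ {x = suc _} _ = ∣m∣n⇒∣m+n

∣∸1-* : ∀ {p} x y → p ∣ x ∸ 1 → p ∣ y ∸ 1 → p ∣ x * y ∸ 1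
∣∸1-* zero    y       _    _    = _ ∣0
∣∸1-* (suc x) zero    _    _    rewrite *-zeroʳ x = _ ∣0
∣∸1-* (suc x) (suc y) p∣x p∣y = ∣m∣n⇒∣m+n p∣y (∣m⇒∣m*n (suc y) p∣x)

∣∸1-^ : ∀ {p} x n → p ∣ x ∸ 1 → p ∣ x ^ n ∸ 1
∣∸1-^ x zero    _   = _ ∣0
∣∸1-^ x (suc n) p∣x = ∣∸1-* x (x ^ n) p∣x (∣∸1-^ x n p∣x)

∣∸1⇒%≡1 : ∀ {p x} .{{_ : NonZero p}} → 1 < p → 0 < x → p ∣ x ∸ 1 → x % p ≡ 1
∣∸1⇒%≡1 {x = suc x} 1<p _ p∣x = trans (%-remove-+ʳ 1 p∣x) (m<n⇒m%n≡m 1<p)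

record CoveringPrime (N a L r p : ℕ) : Set where
  constructor coveringPrime
  field
    1<p       : 1 < p
    p<N∸1     : p < N ∸ 1
    p∣a^L∸1   : p ∣ a ^ L ∸ 1
    p∣N*a^r∸1 : p ∣ N * a ^ r ∸ 1

coveringPrime? : ∀ N a L r p → Dec (CoveringPrime N a L r p)
coveringPrime? N a L r p = map′ (λ (h₁ , h₂ , h₃ , h₄) → coveringPrime h₁ h₂ h₃ h₄)
  (λ (coveringPrime h₁ h₂ h₃ h₄) → h₁ , h₂ , h₃ , h₄)
  (1 <? p ×-dec p <? N ∸ 1 ×-dec p ∣? a ^ L ∸ 1 ×-dec p ∣? N * a ^ r ∸ 1)

covering⇒composite : ∀ {N a L} .{{_ : NonZero a}} .{{_ : NonZero L}} →
                     (∀ (r : Fin L) → ∃[ p ] CoveringPrime N a L (toℕ r) p) →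
                     ∀ n → Composite (N * a ^ n ∸ 1)
covering⇒composite {N} {a} {L} covering n with n divMod L
... | result m r n≡r+m*L with covering r
...   | p , coveringPrime 1<p p<N∸1 p∣a^L∸1 p∣N*a^r∸1 = composite p<N*a^n∸1 p∣N*a^n∸1
  where
  instance
    p-nonTrivial : NonTrivial p
    p-nonTrivial = n>1⇒nonTrivial 1<p
  N*a^n≡N*a^r*a^[m*L] : N * a ^ n ≡ N * a ^ toℕ r * a ^ (m * L)
  N*a^n≡N*a^r*a^[m*L] = trans (cong (λ e → N * a ^ e) n≡r+m*L)
    (trans (cong (N *_) (^-distribˡ-+-* a (toℕ r) (m * L))) (sym (*-assoc N _ _)))
  p∣a^[m*L]∸1 : p ∣ a ^ (m * L) ∸ 1
  p∣a^[m*L]∸1 = subst (λ x → p ∣ x ∸ 1) (trans (^-*-assoc a L m) (cong (a ^_) (*-comm L m)))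
    (∣∸1-^ (a ^ L) m p∣a^L∸1)
  p∣N*a^n∸1 : p ∣ N * a ^ n ∸ 1
  p∣N*a^n∸1 = subst (λ x → p ∣ x ∸ 1) (sym N*a^n≡N*a^r*a^[m*L])
    (∣∸1-* (N * a ^ toℕ r) (a ^ (m * L)) p∣N*a^r∸1 p∣a^[m*L]∸1)
  p<N*a^n∸1 : p < N * a ^ n ∸ 1
  p<N*a^n∸1 = <-≤-trans p<N∸1 (∸-monoˡ-≤ 1 (m≤m*n N (a ^ n) {{m^n≢0 a n}}))

CoveringPrime-+ : ∀ {N E a L r p} .{{_ : NonZero a}} → p ∣ E →
                  CoveringPrime N a L r p → CoveringPrime (N + E) a L r p
CoveringPrime-+ {N} {E} {a} {L} {r} {p} p∣E (coveringPrime 1<p p<N∸1 p∣a^L∸1 p∣N*a^r∸1) =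
  coveringPrime 1<p (<-≤-trans p<N∸1 (∸-monoˡ-≤ 1 (m≤m+n N E))) p∣a^L∸1
    (subst (λ x → p ∣ x ∸ 1) (sym (*-distribʳ-+ (a ^ r) N E))
      (∣∸1-+ N*a^r>0 p∣N*a^r∸1 (∣m⇒∣m*n (a ^ r) p∣E)))
  where
  N*a^r>0 : 0 < N * a ^ r
  N*a^r>0 = *-mono-≤ (<-≤-trans (≤-<-trans z≤n p<N∸1) (m∸n≤m N 1)) (m^n>0 a r)

CoveringPrime-repunit : ∀ {k b o Q a L r p} .{{_ : NonZero a}} q → p ∣ repunit b Q →
                        CoveringPrime (k * repunit b o) a L r p →
                        CoveringPrime (k * repunit b (o + q * Q)) a L r p
CoveringPrime-repunit {k} {b} {o} {Q} {a} {L} {r} {p} q p∣R[Q] covers =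
  subst (λ N → CoveringPrime N a L r p) (sym R[o+q*Q]-split) (CoveringPrime-+ p∣E covers)
  where
  R[o+q*Q]-split : k * repunit b (o + q * Q) ≡ k * repunit b o + k * (b ^ o * repunit b (q * Q))
  R[o+q*Q]-split = trans (cong (k *_) (repunit-+ b o (q * Q))) (*-distribˡ-+ k _ _)
  p∣E : p ∣ k * (b ^ o * repunit b (q * Q))
  p∣E = ∣n⇒∣m*n k (∣n⇒∣m*n (b ^ o) (∣-trans p∣R[Q] (repunit∣repunit[q*n] b Q q)))

coveringPrimes : Vec ℕ 24
coveringPrimes = 5 ∷ 3 ∷ 13 ∷ 3 ∷ 5 ∷ 3 ∷ 7 ∷ 3 ∷ 5 ∷ 3 ∷ 17 ∷ 3 ∷ 5 ∷ 3 ∷ 13 ∷ 3 ∷ 5 ∷ 3 ∷ 7 ∷ 3 ∷ 5 ∷ 3 ∷ 241 ∷ 3 ∷ []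

coveringPrimes-valid : ∀ r → CoveringPrime (18107 * repunit (2 ^ 15) 31) 2 24 (toℕ r) (lookup coveringPrimes r)
                           × lookup coveringPrimes r ∣ repunit (2 ^ 15) 56
coveringPrimes-valid = toWitness {a? = all? λ r →
  coveringPrime? (18107 * repunit (2 ^ 15) 31) 2 24 (toℕ r) (lookup coveringPrimes r)
  ×-dec lookup coveringPrimes r ∣? repunit (2 ^ 15) 56} _

covering⇒RieselNumber : ∀ {N L} .{{_ : NonZero L}} → 0 < N → 2 ∣ N ∸ 1 →
                        (∀ (r : Fin L) → ∃[ p ] CoveringPrime N 2 L (toℕ r) p) → RieselNumber N
covering⇒RieselNumber N>0 2∣N∸1 covering =
  N>0 , ∣∸1⇒%≡1 (s≤s (s≤s z≤n)) N>0 2∣N∸1 , λ n _ → covering⇒composite covering n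

-- Below, implicit arguments are given wherever inferring them would make Agda
-- normalise terms like ⌊log₂ 18107 ⌋ or 18107 * repunit (2 ^ 15) (31 + q * 56)
-- by unary unfolding, which does not terminate in practice.
18107*repunit-Riesel : ∀ q → RieselNumber (18107 * repunit (2 ^ 15) (31 + q * 56))
18107*repunit-Riesel q = covering⇒RieselNumber N>0 2∣N∸1 covering
  where
  t>0 : 0 < 31 + q * 56
  t>0 = s≤s z≤n
  N>0 : 0 < 18107 * repunit (2 ^ 15) (31 + q * 56)
  N>0 = *-mono-≤ {1} {18107} {1} {repunit (2 ^ 15) (31 + q * 56)} (s≤s z≤n) (repunit>0 (2 ^ 15) t>0)
  2∣N∸1 : 2 ∣ 18107 * repunit (2 ^ 15) (31 + q * 56) ∸ 1
  2∣N∸1 = ∣∸1-* 18107 (repunit (2 ^ 15) (31 + q * 56)) (divides 9053 refl)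
    (∣b⇒∣repunit∸1 {2} {2 ^ 15} {31 + q * 56} (divides (2 ^ 14) refl) t>0)
  covering : ∀ r → ∃[ p ] CoveringPrime (18107 * repunit (2 ^ 15) (31 + q * 56)) 2 24 (toℕ r) p
  covering r = lookup coveringPrimes r ,
    CoveringPrime-repunit {18107} {2 ^ 15} {31} {56} q (proj₂ (coveringPrimes-valid r)) (proj₁ (coveringPrimes-valid r))

len₂[18107]≡15 : len₂ 18107 ≡ 15
len₂[18107]≡15 = len₂≡1+m 14 {18107} (≤ᵇ⇒≤ (2 ^ 14) 18107 _) (≤ᵇ⇒≤ 18108 (2 ^ 15) _)

theorem3p6 : (t : ℕ) → 1 ≤ t → t % 56 ≡ 31 → RieselNumber (repint₂ 18107 t)
theorem3p6 t _ t%56≡31 =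
  subst RieselNumber {x = 18107 * repunit (2 ^ 15) (31 + t / 56 * 56)} N≡repint₂ (18107*repunit-Riesel (t / 56))
  where
  open ≡-Reasoning
  t≡31+[t/56]*56 : t ≡ 31 + t / 56 * 56
  t≡31+[t/56]*56 = trans (m≡m%n+[m/n]*n t 56) (cong (_+ t / 56 * 56) t%56≡31)
  N≡repint₂ : 18107 * repunit (2 ^ 15) (31 + t / 56 * 56) ≡ repint₂ 18107 t
  N≡repint₂ = begin
    18107 * repunit (2 ^ 15) (31 + t / 56 * 56)
      ≡⟨ cong (λ s → 18107 * repunit (2 ^ 15) s) {31 + t / 56 * 56} {t} (sym t≡31+[t/56]*56) ⟩
    18107 * repunit (2 ^ 15) t
      ≡⟨ cong (λ ℓ → 18107 * repunit (2 ^ ℓ) t) {15} {len₂ 18107} (sym len₂[18107]≡15) ⟩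
    18107 * repunit (2 ^ len₂ 18107) t
      ≡⟨ sym (repint₂≡k*repunit 18107 t) ⟩
    repint₂ 18107 t
      ∎
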